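{- Let $G$ be a connected bipartite graph with at least two vertices that has a Hamiltonian path, and let $k \ge 2$. Then $F(G \,\square\, P_k) = \alpha(G \,\square\, P_k) - 1$, where $P_k$ is the path on $k$ vertices.
   Context: Peg solitaire on a graph: a configuration assigns to each vertex either a peg or a hole. If $x,y,z$ form a path $xyz$ with pegs at $x$ and $y$ and a hole at $z$, a jump $xyz$ removes the pegs at $x$ and $y$ and places a peg at $z$. A terminal state of a graph $G$ is the set of peg locations when no jump is available, reached by some sequence of jumps from a starting configuration with exactly one hole (and pegs on all other vertices). The fool's solitaire number $F(G)$ is the maximum size of a terminal state of $G$. $\alpha$ is the independence number. The cartesian product $G \,\square\, H$ has vertex set $V(G)\times V(H)$, two vertices being adjacent iff they are equal in one coordinate and adjacent in the other. -}

module Defs where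

open import Data.Nat using (ℕ; zero; suc; _*_; _+_; _≤_; _≡ᵇ_)
open import Data.Bool using (Bool; true; false; not; _∧_; _∨_; if_then_else_)
open import Data.Fin using (Fin; toℕ; remQuot; _≟_)
import Data.Fin as F
open import Data.Product using (Σ; ∃; _×_; _,_; proj₁; proj₂)
open import Relation.Binary.PropositionalEquality using (_≡_; _≢_)
open import Relation.Nullary using (¬_)
open import Relation.Nullary.Decidable using (⌊_⌋)
open import Relation.Binary.Construct.Closure.ReflexiveTransitive using (Star)
open import Function.Definitions using (Injective)

Graph : ℕ → Set
Graph n = Fin n → Fin n → Bool

IsSimpleGraph : ∀ {n} → Graph n → Set
IsSimpleGraph {n} G = (∀ u v → G u v ≡ G v u) × (∀ u → G u u ≡ false)

Adjacent : ∀ {n} → Graph n → Fin n → Fin n → Set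
Adjacent G u v = G u v ≡ true

Connected : ∀ {n} → Graph n → Set
Connected {n} G = ∀ (u v : Fin n) → Star (Adjacent G) u v

Bipartite : ∀ {n} → Graph n → Set
Bipartite {n} G = Σ (Fin n → Bool) λ c → ∀ u v → Adjacent G u v → c u ≢ c v

-- Hamiltonian path: an ordering σ of all vertices (σ injective on Fin n, hence a
-- bijection) with consecutive vertices adjacent.
HasHamiltonianPath : ∀ {n} → Graph n → Set
HasHamiltonianPath {n} G =
  Σ (Fin n → Fin n) λ σ → Injective _≡_ _≡_ σ ×
    (∀ (i j : Fin n) → toℕ j ≡ suc (toℕ i) → Adjacent G (σ i) (σ j))

PathGraph : (k : ℕ) → Graph k
PathGraph k i j = (toℕ j ≡ᵇ suc (toℕ i)) ∨ (toℕ i ≡ᵇ suc (toℕ j))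

_□_ : ∀ {n k} → Graph n → Graph k → Graph (n * k)
_□_ {n} {k} G H w w' with remQuot {n} k w | remQuot {n} k w'
... | (g , h) | (g' , h') = (⌊ g ≟ g' ⌋ ∧ H h h') ∨ (⌊ h ≟ h' ⌋ ∧ G g g')

-- Configurations: true = peg, false = hole.
Config : ℕ → Set
Config n = Fin n → Bool

pegCount : ∀ {n} → Config n → ℕ
pegCount {zero} c = 0
pegCount {suc n} c = (if c F.zero then 1 else 0) + pegCount (λ i → c (F.suc i))

IsPath3 : ∀ {n} → Graph n → Fin n → Fin n → Fin n → Set
IsPath3 G x y z = Adjacent G x y × Adjacent G y z × x ≢ z

JumpAt : ∀ {n} → Graph n → Config n → Fin n → Fin n → Fin n → Set
JumpAt G C x y z = IsPath3 G x y z × C x ≡ true × C y ≡ true × C z ≡ false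

afterJump : ∀ {n} → Config n → Fin n → Fin n → Fin n → Config n
afterJump C x y z v =
  if ⌊ v ≟ z ⌋ then true
  else if ⌊ v ≟ x ⌋ ∨ ⌊ v ≟ y ⌋ then false
  else C v

Jump : ∀ {n} → Graph n → Config n → Config n → Set
Jump {n} G C C' = Σ (Fin n) λ x → Σ (Fin n) λ y → Σ (Fin n) λ z →
  JumpAt G C x y z × (∀ v → C' v ≡ afterJump C x y z v)

JumpAvailable : ∀ {n} → Graph n → Config n → Set
JumpAvailable {n} G C = Σ (Fin n) λ x → Σ (Fin n) λ y → Σ (Fin n) λ z → JumpAt G C x y z

start : ∀ {n} → Fin n → Config n
start h v = not ⌊ v ≟ h ⌋

IsTerminalState : ∀ {n} → Graph n → Config n → Set
IsTerminalState {n} G T =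
  (Σ (Fin n) λ h → Star (Jump G) (start h) T) × ¬ JumpAvailable G T

IsMax : (ℕ → Set) → ℕ → Set
IsMax P m = P m × (∀ j → P j → j ≤ m)

IsFoolsSolitaireNumber : ∀ {n} → Graph n → ℕ → Set
IsFoolsSolitaireNumber {n} G =
  IsMax (λ s → Σ (Config n) λ T → IsTerminalState G T × pegCount T ≡ s)

IsIndependent : ∀ {n} → Graph n → Config n → Set
IsIndependent G S = ∀ u v → S u ≡ true → S v ≡ true → G u v ≡ false

IsIndependenceNumber : ∀ {n} → Graph n → ℕ → Set
IsIndependenceNumber {n} G =
  IsMax (λ s → Σ (Config n) λ S → IsIndependent G S × pegCount S ≡ s)

-- Relabel G □ P_k along a Hamiltonian path of the grid P_n □ P_k, whose rows are sent to the
-- vertices of G in the order of its Hamiltonian path; when nk is even the grid path is chosen to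
-- close up to a Hamiltonian cycle. It then suffices to treat a bipartite graph on N ≥ 4 vertices
-- in which 0, 1, …, N − 1 is a Hamiltonian path, closed to a cycle when N is even. Adjacent
-- vertices have positions of different parity, so the even positions give α = ⌈N/2⌉. A terminal
-- state is independent: in a stuck configuration two adjacent pegs force pegs all along the path
-- up to any hole. The two holes left by the last jump are adjacent, hence of different parity,
-- and a set of pairwise non-consecutive positions missing an even and an odd position (and, when
-- N is even, not containing both ends of the cycle) has fewer than N/2 elements; so F ≤ α − 1.
-- Conversely the sweep from the hole at 0 jumping 2, 1 → 0, then 4, 3 → 2, and so on, finished
-- when N is even by one jump around the cycle, stops with pegs on ⌈N/2⌉ − 1 even positions.

module Submission where

open import Defs
open import Data.Nat using (ℕ; zero; suc; _+_; _*_; _≤_; _<_; _∸_; _≡ᵇ_; z≤n; s≤s; s≤s⁻¹; parity)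
import Data.Nat.Properties as ℕ
open import Data.Parity.Base using (Parity; 0ℙ; 1ℙ; _⁻¹) renaming (_*_ to _ℙ*_)
import Data.Parity.Properties as ℙ
open import Data.Bool using (Bool; true; false; not; _∧_; _∨_; _xor_; if_then_else_)
import Data.Bool.Properties as B
open import Data.Fin using (Fin; toℕ; _≟_; _↑ˡ_; _↑ʳ_; splitAt; combine; remQuot)
import Data.Fin as F
import Data.Fin.Properties as F
open import Data.Fin.Permutation
  using (Permutation; permutation; _⟨$⟩ʳ_; _⟨$⟩ˡ_; inverseˡ; inverseʳ; flip)
import Algebra.Properties.CommutativeMonoid.Sum as Sum
open import Data.Empty using (⊥; ⊥-elim)
open import Data.Product using (Σ-syntax; ∃-syntax; _×_; _,_; proj₁; proj₂; swap)
open import Data.Sum using (_⊎_; inj₁; inj₂; [_,_]′)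
open import Function using (_∘_; _on_; mk⇔)
open import Function.Bundles using (_⇔_; Equivalence)
open import Function.Definitions using (Injective)
open import Relation.Binary using (tri<; tri≈; tri>)
open import Relation.Binary.PropositionalEquality
open import Relation.Binary.Construct.Closure.ReflexiveTransitive using (Star; ε; _◅_; _◅◅_)
open import Relation.Nullary using (¬_; yes; no)
open import Relation.Nullary.Decidable using (Dec; ⌊_⌋; does-⇔; isYes≗does; dec-true; dec-false)


double : ℕ → ℕ
double zero = zero
double (suc n) = suc (suc (double n))

parity-double : ∀ n → parity (double n) ≡ 0ℙ
parity-double zero = refl
parity-double (suc n) = parity-double n

halve : ∀ n → ∃[ t ] (n ≡ double t ⊎ n ≡ suc (double t))
halve zero = 0 , inj₁ refl
halve (suc zero) = 0 , inj₂ refl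
halve (suc (suc n)) with halve n
... | t , inj₁ refl = suc t , inj₁ refl
... | t , inj₂ refl = suc t , inj₂ refl

≤double : ∀ n → n ≤ double n
≤double zero = z≤n
≤double (suc n) = s≤s (ℕ.m≤n⇒m≤1+n (≤double n))

double-mono-≤ : ∀ {m n} → m ≤ n → double m ≤ double n
double-mono-≤ z≤n = z≤n
double-mono-≤ (s≤s m≤n) = s≤s (s≤s (double-mono-≤ m≤n))

double≤1+double⇒≤ : ∀ {a c} → double a ≤ suc (double c) → a ≤ c
double≤1+double⇒≤ {zero} _ = z≤n
double≤1+double⇒≤ {suc a} {suc c} (s≤s (s≤s le)) = s≤s (double≤1+double⇒≤ le)

1+double≤double⇒≤∸1 : ∀ {j a} → suc (double j) ≤ double a → j ≤ a ∸ 1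
1+double≤double⇒≤∸1 {a = suc a} (s≤s le) = double≤1+double⇒≤ le

parity-pred : ∀ n {p} → parity (suc n) ≡ p → parity n ≡ p ⁻¹
parity-pred n refl = sym (ℙ.suc-homo-⁻¹ n)

odd⇒positive : ∀ {n} → parity n ≡ 1ℙ → 0 < n
odd⇒positive {suc n} _ = s≤s z≤n

flipBy : Parity → Bool → Bool
flipBy 0ℙ b = b
flipBy 1ℙ b = not b

flipBy-suc : ∀ n b → flipBy (parity (suc n)) b ≡ not (flipBy (parity n) b)
flipBy-suc zero b = refl
flipBy-suc (suc zero) b = sym (B.not-involutive b)
flipBy-suc (suc (suc n)) b = flipBy-suc n b

true≢false : true ≢ false
true≢false ()

⌊⌋-⇔ : ∀ {A B : Set} → A ⇔ B → (a? : Dec A) (b? : Dec B) → ⌊ a? ⌋ ≡ ⌊ b? ⌋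
⌊⌋-⇔ A⇔B a? b? = trans (isYes≗does a?) (trans (does-⇔ A⇔B a? b?) (sym (isYes≗does b?)))

⌊≟⌋-refl : ∀ {n} (u : Fin n) → ⌊ u ≟ u ⌋ ≡ true
⌊≟⌋-refl u = trans (isYes≗does (u ≟ u)) (dec-true (u ≟ u) refl)

⌊≟⌋-≢ : ∀ {n} {u v : Fin n} → u ≢ v → ⌊ u ≟ v ⌋ ≡ false
⌊≟⌋-≢ {u = u} {v} u≢v = trans (isYes≗does (u ≟ v)) (dec-false (u ≟ v) u≢v)

⌊≟⌋-sym : ∀ {n} (u v : Fin n) → ⌊ u ≟ v ⌋ ≡ ⌊ v ≟ u ⌋
⌊≟⌋-sym u v = ⌊⌋-⇔ (mk⇔ sym sym) (u ≟ v) (v ≟ u)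

⌊≟⌋≡toℕ-≡ᵇ : ∀ {n} (u v : Fin n) → ⌊ u ≟ v ⌋ ≡ (toℕ u ≡ᵇ toℕ v)
⌊≟⌋≡toℕ-≡ᵇ u v =
  trans (⌊⌋-⇔ (mk⇔ (cong toℕ) F.toℕ-injective) (u ≟ v) (toℕ u ℕ.≟ toℕ v))
        (isYes≗does (toℕ u ℕ.≟ toℕ v))

≡ᵇ-≢ : ∀ {m n} → m ≢ n → (m ≡ᵇ n) ≡ false
≡ᵇ-≢ {m} {n} m≢n = dec-false (m ℕ.≟ n) m≢n

≡ᵇ-≡ : ∀ {m n} → m ≡ n → (m ≡ᵇ n) ≡ true
≡ᵇ-≡ {m} {n} m≡n = dec-true (m ℕ.≟ n) m≡n

≡ᵇ⇒≡ : ∀ {m n} → (m ≡ᵇ n) ≡ true → m ≡ n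
≡ᵇ⇒≡ {m} {n} e = ℕ.≡ᵇ⇒≡ m n (Equivalence.from B.T-≡ e)

xor-≢ˡ : ∀ {x x′} z → x ≢ x′ → x xor z ≢ x′ xor z
xor-≢ˡ {x} {x′} false x≢x′ rewrite B.xor-identityʳ x | B.xor-identityʳ x′ = x≢x′
xor-≢ˡ {x} {x′} true x≢x′ rewrite B.xor-comm x true | B.xor-comm x′ true = x≢x′ ∘ B.not-injective

xor-≢ʳ : ∀ x {z z′} → z ≢ z′ → x xor z ≢ x xor z′
xor-≢ʳ x {z} {z′} z≢z′ e = xor-≢ˡ x z≢z′ (trans (B.xor-comm z x) (trans e (B.xor-comm x z′)))

open Sum ℕ.+-0-commutativeMonoid using (sum; sum-permute)

pegCount≡sum : ∀ {n} (c : Config n) → pegCount c ≡ sum (λ v → if c v then 1 else 0)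
pegCount≡sum {zero} c = refl
pegCount≡sum {suc n} c = cong ((if c F.zero then 1 else 0) +_) (pegCount≡sum (c ∘ F.suc))

pegCount-permute : ∀ {n} (c : Config n) (π : Permutation n n) →
  pegCount (c ∘ (π ⟨$⟩ʳ_)) ≡ pegCount c
pegCount-permute c π = begin
  pegCount (c ∘ (π ⟨$⟩ʳ_))                   ≡⟨ pegCount≡sum (c ∘ (π ⟨$⟩ʳ_)) ⟩
  sum (λ v → if c (π ⟨$⟩ʳ v) then 1 else 0)  ≡⟨ sum-permute (λ v → if c v then 1 else 0) π ⟨
  sum (λ v → if c v then 1 else 0)           ≡⟨ pegCount≡sum c ⟨
  pegCount c                                 ∎
  where open ≡-Reasoning

pegCount-cong : ∀ {n} {c d : Config n} → (∀ v → c v ≡ d v) → pegCount c ≡ pegCount d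
pegCount-cong {zero} c≗d = refl
pegCount-cong {suc n} c≗d =
  cong₂ _+_ (cong (λ b → if b then 1 else 0) (c≗d F.zero)) (pegCount-cong (c≗d ∘ F.suc))

pegCount-reindex : ∀ {m n} → m ≡ n → (f : ℕ → Bool) →
  pegCount {m} (λ v → f (toℕ v)) ≡ pegCount {n} (λ v → f (toℕ v))
pegCount-reindex refl f = refl

Sparse : ∀ {m} → Config m → Set
Sparse {m} c = ∀ (i j : Fin m) → toℕ j ≡ suc (toℕ i) → c i ≡ true → c j ≡ false

Sparse-tail : ∀ {m} {c : Config (suc m)} → Sparse c → Sparse (c ∘ F.suc)
Sparse-tail sp i j j≡1+i = sp (F.suc i) (F.suc j) (cong suc j≡1+i)

sparse-count : ∀ {m} (c : Config m) → Sparse c → double (pegCount c) ≤ suc m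
sparse-count {zero} c sp = z≤n
sparse-count {suc m} c sp with c F.zero in c₀
... | false = ℕ.m≤n⇒m≤1+n (sparse-count (c ∘ F.suc) (Sparse-tail sp))
sparse-count {suc zero} c sp | true = ℕ.≤-refl
sparse-count {suc (suc m)} c sp | true rewrite sp F.zero (F.suc F.zero) refl c₀ =
  s≤s (s≤s (sparse-count (c ∘ F.suc ∘ F.suc) (Sparse-tail (Sparse-tail sp))))

sparse-count-evenHole : ∀ {m} (c : Config m) → Sparse c → (e : Fin m) → c e ≡ false →
  parity (toℕ e) ≡ 0ℙ → double (pegCount c) ≤ m
sparse-count-evenHole {suc m} c sp e ce pe with c F.zero in c₀
... | false = sparse-count (c ∘ F.suc) (Sparse-tail sp)
sparse-count-evenHole {suc m} c sp F.zero ce pe | true with () ← trans (sym c₀) ce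
sparse-count-evenHole {suc m} c sp (F.suc F.zero) ce () | true
sparse-count-evenHole {suc (suc m)} c sp (F.suc (F.suc e)) ce pe | true
  rewrite sp F.zero (F.suc F.zero) refl c₀ =
  s≤s (s≤s (sparse-count-evenHole (c ∘ F.suc ∘ F.suc) (Sparse-tail (Sparse-tail sp)) e ce pe))

sparse-count-evenHole<oddHole : ∀ {m} (c : Config m) → Sparse c → (i j : Fin m) →
  c i ≡ false → parity (toℕ i) ≡ 0ℙ → c j ≡ false → parity (toℕ j) ≡ 1ℙ → toℕ i < toℕ j →
  double (pegCount c) < m
sparse-count-evenHole<oddHole {suc m} c sp i j ci pi cj pj i<j with c F.zero in c₀
sparse-count-evenHole<oddHole {suc m} c sp i (F.suc j) ci pi cj pj i<j | false =
  s≤s (sparse-count-evenHole (c ∘ F.suc) (Sparse-tail sp) j cj (parity-pred (toℕ j) pj))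
sparse-count-evenHole<oddHole {suc m} c sp F.zero j ci pi cj pj i<j | true
  with () ← trans (sym c₀) ci
sparse-count-evenHole<oddHole {suc m} c sp (F.suc F.zero) j ci () cj pj i<j | true
sparse-count-evenHole<oddHole {suc (suc m)} c sp (F.suc (F.suc i)) (F.suc (F.suc j)) ci pi cj pj
  (s≤s (s≤s i<j)) | true rewrite sp F.zero (F.suc F.zero) refl c₀ =
  s≤s (s≤s (sparse-count-evenHole<oddHole (c ∘ F.suc ∘ F.suc) (Sparse-tail (Sparse-tail sp))
    i j ci pi cj pj i<j))

sparse-count-cyclic : ∀ {m} (c : Config (suc m)) → Sparse c → parity (suc m) ≡ 0ℙ →
  (c F.zero ≡ true → c (F.fromℕ m) ≡ false) → (i j : Fin (suc m)) →
  c i ≡ false → parity (toℕ i) ≡ 0ℙ → c j ≡ false → parity (toℕ j) ≡ 1ℙ →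
  double (pegCount c) < suc m
-- A hole at 0 is an even hole before j; otherwise the last position, odd as m + 1 is even, is a
-- hole after i.
sparse-count-cyclic {m} c sp even wrap i j ci pi cj pj with c F.zero B.≟ true
... | no c₀≢true =
  sparse-count-evenHole<oddHole c sp F.zero j (B.¬-not c₀≢true) refl cj pj (odd⇒positive pj)
... | yes c₀ = sparse-count-evenHole<oddHole c sp i (F.fromℕ m) ci pi (wrap c₀) p-last i<last
  where
  p-last : parity (toℕ (F.fromℕ m)) ≡ 1ℙ
  p-last rewrite F.toℕ-fromℕ m = parity-pred m even
  i<last : toℕ i < toℕ (F.fromℕ m)
  i<last rewrite F.toℕ-fromℕ m = ℕ.≤∧≢⇒< (F.toℕ≤pred[n] i) λ i≡m →
    ℙ.p≢p⁻¹ 0ℙ (trans (sym pi) (trans (cong parity i≡m) (parity-pred m even)))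

sparse-count-evenOddHoles : ∀ {m} (c : Config (suc m)) → Sparse c →
  (parity (suc m) ≡ 0ℙ → c F.zero ≡ true → c (F.fromℕ m) ≡ false) → (i j : Fin (suc m)) →
  c i ≡ false → parity (toℕ i) ≡ 0ℙ → c j ≡ false → parity (toℕ j) ≡ 1ℙ →
  double (pegCount c) < suc m
sparse-count-evenOddHoles {m} c sp wrap i j ci pi cj pj with parity (suc m) in pN
... | 0ℙ = sparse-count-cyclic c sp pN (wrap refl) i j ci pi cj pj
... | 1ℙ = ℕ.≤∧≢⇒< (sparse-count-evenHole c sp i ci pi) λ 2c≡N →
  ℙ.p≢p⁻¹ 0ℙ (trans (sym (parity-double (pegCount c))) (trans (cong parity 2c≡N) pN))

sparse-count-oppositeHoles : ∀ {m} (c : Config (suc m)) → Sparse c →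
  (parity (suc m) ≡ 0ℙ → c F.zero ≡ true → c (F.fromℕ m) ≡ false) → (i j : Fin (suc m)) →
  c i ≡ false → c j ≡ false → parity (toℕ i) ≢ parity (toℕ j) →
  double (pegCount c) < suc m
sparse-count-oppositeHoles c sp wrap i j ci cj i≢j
  with parity (toℕ i) in pi | parity (toℕ j) in pj
... | 0ℙ | 0ℙ = ⊥-elim (i≢j refl)
... | 1ℙ | 1ℙ = ⊥-elim (i≢j refl)
... | 0ℙ | 1ℙ = sparse-count-evenOddHoles c sp wrap i j ci pi cj pj
... | 1ℙ | 0ℙ = sparse-count-evenOddHoles c sp wrap j i cj pj ci pi

start-peg : ∀ {n} {h u : Fin n} → u ≢ h → start h u ≡ true
start-peg u≢h = cong not (⌊≟⌋-≢ u≢h)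

start-hole : ∀ {n} (h : Fin n) → start h h ≡ false
start-hole h = cong not (⌊≟⌋-refl h)

afterJump-source : ∀ {n} (C : Config n) {x z} y → x ≢ z → afterJump C x y z x ≡ false
afterJump-source C {x} y x≢z rewrite ⌊≟⌋-≢ x≢z | ⌊≟⌋-refl x = refl

afterJump-middle : ∀ {n} (C : Config n) x {y z} → y ≢ z → afterJump C x y z y ≡ false
afterJump-middle C x {y} y≢z rewrite ⌊≟⌋-≢ y≢z | ⌊≟⌋-refl y | B.∨-zeroʳ ⌊ y ≟ x ⌋ = refl

independent⇒stuck : ∀ {n} {G : Graph n} {C} → IsIndependent G C → ¬ JumpAvailable G C
independent⇒stuck ind (x , y , _ , (xy , _) , Cx , Cy , _) =
  true≢false (trans (sym xy) (ind x y Cx Cy))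

star-last : ∀ {A : Set} {R : A → A → Set} {a b} → Star R a b → a ≡ b ⊎ ∃[ c ] R c b
star-last ε = inj₁ refl
star-last (r ◅ rs) with star-last rs
... | inj₁ refl = inj₂ (_ , r)
... | inj₂ last = inj₂ last

IsMax-map : ∀ {P Q : ℕ → Set} {m} → (∀ {s} → P s → Q s) → (∀ {s} → Q s → P s) →
  IsMax P m → IsMax Q m
IsMax-map P⇒Q Q⇒P (Pm , max) = P⇒Q Pm , λ j Qj → max j (Q⇒P Qj)

module Relabel {n} (G G′ : Graph n) (π : Permutation n n)
               (G′≡G∘π : ∀ u v → G′ u v ≡ G (π ⟨$⟩ʳ u) (π ⟨$⟩ʳ v)) where

  push : Config n → Config n
  push C = C ∘ (π ⟨$⟩ˡ_)

  pegCount-push : ∀ C → pegCount (push C) ≡ pegCount C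
  pegCount-push C = pegCount-permute C (flip π)

  ≟-push : ∀ v u → ⌊ π ⟨$⟩ˡ v ≟ u ⌋ ≡ ⌊ v ≟ π ⟨$⟩ʳ u ⌋
  ≟-push v u = ⌊⌋-⇔ (mk⇔ (λ { refl → sym (inverseʳ π) }) (λ { refl → inverseˡ π })) _ _

  independent-push : ∀ {S} → IsIndependent G′ S → IsIndependent G (push S)
  independent-push ind u v Su Sv = begin
    G u v                                    ≡⟨ cong₂ G (inverseʳ π) (inverseʳ π) ⟨
    G (π ⟨$⟩ʳ (π ⟨$⟩ˡ u)) (π ⟨$⟩ʳ (π ⟨$⟩ˡ v))  ≡⟨ G′≡G∘π _ _ ⟨
    G′ (π ⟨$⟩ˡ u) (π ⟨$⟩ˡ v)                  ≡⟨ ind _ _ Su Sv ⟩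
    false                                    ∎
    where open ≡-Reasoning

  module _ {C D : Config n} (D≗pushC : ∀ v → D v ≡ push C v) where

    jumpAt-push : ∀ {x y z} → JumpAt G′ C x y z →
      JumpAt G D (π ⟨$⟩ʳ x) (π ⟨$⟩ʳ y) (π ⟨$⟩ʳ z)
    jumpAt-push ((xy , yz , x≢z) , Cx , Cy , Cz) =
      (trans (sym (G′≡G∘π _ _)) xy , trans (sym (G′≡G∘π _ _)) yz ,
       λ πx≡πz → x≢z (trans (sym (inverseˡ π)) (trans (cong (π ⟨$⟩ˡ_) πx≡πz) (inverseˡ π)))) ,
      pegAt Cx , pegAt Cy , pegAt Cz
      where
      pegAt : ∀ {u b} → C u ≡ b → D (π ⟨$⟩ʳ u) ≡ b
      pegAt Cu = trans (D≗pushC _) (trans (cong C (inverseˡ π)) Cu)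

    afterJump-push : ∀ x y z v →
      push (afterJump C x y z) v ≡ afterJump D (π ⟨$⟩ʳ x) (π ⟨$⟩ʳ y) (π ⟨$⟩ʳ z) v
    afterJump-push x y z v
      rewrite ≟-push v z | ≟-push v x | ≟-push v y | D≗pushC v = refl

    jump-push : ∀ {C′} → Jump G′ C C′ → Jump G D (push C′)
    jump-push (x , y , z , jumpAt , C′≗) =
      π ⟨$⟩ʳ x , π ⟨$⟩ʳ y , π ⟨$⟩ʳ z , jumpAt-push jumpAt ,
      λ v → trans (C′≗ _) (afterJump-push x y z v)

  -- Configurations are functions: a transported play ends only pointwise equal to push T.
  play-push : ∀ {C D T} → (∀ v → D v ≡ push C v) → Star (Jump G′) C T →
    ∃[ T′ ] Star (Jump G) D T′ × (∀ v → T′ v ≡ push T v)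
  play-push D≗ ε = _ , ε , D≗
  play-push D≗ (j ◅ js) with play-push (λ _ → refl) js
  ... | T′ , play , T′≗ = T′ , jump-push D≗ j ◅ play , T′≗

  jumpAvailable-pull : ∀ {C D} → (∀ v → D v ≡ push C v) → JumpAvailable G D → JumpAvailable G′ C
  jumpAvailable-pull D≗ (x , y , z , (xy , yz , x≢z) , Dx , Dy , Dz) =
    π ⟨$⟩ˡ x , π ⟨$⟩ˡ y , π ⟨$⟩ˡ z ,
    (adjacent-pull xy , adjacent-pull yz ,
     λ x≡z → x≢z (trans (sym (inverseʳ π)) (trans (cong (π ⟨$⟩ʳ_) x≡z) (inverseʳ π)))) ,
    trans (sym (D≗ x)) Dx , trans (sym (D≗ y)) Dy , trans (sym (D≗ z)) Dz
    where
    adjacent-pull : ∀ {u v} → Adjacent G u v → Adjacent G′ (π ⟨$⟩ˡ u) (π ⟨$⟩ˡ v)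
    adjacent-pull uv = trans (G′≡G∘π _ _) (trans (cong₂ G (inverseʳ π) (inverseʳ π)) uv)

  start-push : ∀ h v → start (π ⟨$⟩ʳ h) v ≡ push (start h) v
  start-push h v = cong not (sym (≟-push v h))

  terminal-push : ∀ {T} → IsTerminalState G′ T →
    ∃[ T′ ] IsTerminalState G T′ × pegCount T′ ≡ pegCount T
  terminal-push {T} ((h , play) , stuck) with play-push (start-push h) play
  ... | T′ , play′ , T′≗ =
    T′ , ((π ⟨$⟩ʳ h , play′) , stuck ∘ jumpAvailable-pull T′≗) ,
    trans (pegCount-cong {c = T′} T′≗) (pegCount-push T)

relabel-inverse : ∀ {n} {G G′ : Graph n} (π : Permutation n n) →
  (∀ u v → G′ u v ≡ G (π ⟨$⟩ʳ u) (π ⟨$⟩ʳ v)) →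
  ∀ u v → G u v ≡ G′ (π ⟨$⟩ˡ u) (π ⟨$⟩ˡ v)
relabel-inverse {G = G} π G′≡G∘π u v =
  trans (sym (cong₂ G (inverseʳ π) (inverseʳ π))) (sym (G′≡G∘π _ _))

foolsNumber-relabel : ∀ {n} {G G′ : Graph n} (π : Permutation n n) →
  (∀ u v → G′ u v ≡ G (π ⟨$⟩ʳ u) (π ⟨$⟩ʳ v)) →
  ∀ {m} → IsFoolsSolitaireNumber G′ m → IsFoolsSolitaireNumber G m
foolsNumber-relabel {G = G} {G′} π G′≡G∘π = IsMax-map
  (λ { (_ , term , refl) → ⇒.terminal-push term })
  (λ { (_ , term , refl) → ⇐.terminal-push term })
  where
  module ⇒ = Relabel G G′ π G′≡G∘π
  module ⇐ = Relabel G′ G (flip π) (relabel-inverse π G′≡G∘π)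

independenceNumber-relabel : ∀ {n} {G G′ : Graph n} (π : Permutation n n) →
  (∀ u v → G′ u v ≡ G (π ⟨$⟩ʳ u) (π ⟨$⟩ʳ v)) →
  ∀ {a} → IsIndependenceNumber G a → IsIndependenceNumber G′ a
independenceNumber-relabel {G = G} {G′} π G′≡G∘π = IsMax-map
  (λ { (S , ind , refl) → ⇐.push S , ⇐.independent-push ind , ⇐.pegCount-push S })
  (λ { (S , ind , refl) → ⇒.push S , ⇒.independent-push ind , ⇒.pegCount-push S })
  where
  module ⇒ = Relabel G G′ π G′≡G∘π
  module ⇐ = Relabel G′ G (flip π) (relabel-inverse π G′≡G∘π)

on-simple : ∀ {m n} {G : Graph n} (f : Fin m → Fin n) → IsSimpleGraph G → IsSimpleGraph (G on f)
on-simple f (G-sym , G-irr) = (λ u v → G-sym (f u) (f v)) , G-irr ∘ f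

on-bipartite : ∀ {m n} {G : Graph n} (f : Fin m → Fin n) → Bipartite G → Bipartite (G on f)
on-bipartite f (c , proper) = c ∘ f , λ u v → proper (f u) (f v)

-- The sweep

-- The configuration on positions 0, 1, 2, … after t jumps of the sweep that starts with the
-- hole at 0 and whose (t+1)-st jump is 2t+2, 2t+1 → 2t.
sweep : ℕ → ℕ → Bool
sweep zero zero = false
sweep zero (suc p) = true
sweep (suc t) zero = true
sweep (suc t) (suc zero) = false
sweep (suc t) (suc (suc p)) = sweep t p

sweep-step : ∀ t p → sweep (suc t) p ≡
  (if p ≡ᵇ double t then true
   else if (p ≡ᵇ suc (suc (double t))) ∨ (p ≡ᵇ suc (double t)) then false else sweep t p)
sweep-step zero zero = refl
sweep-step zero (suc zero) = refl
sweep-step zero (suc (suc zero)) = refl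
sweep-step zero (suc (suc (suc p))) = refl
sweep-step (suc t) zero = refl
sweep-step (suc t) (suc zero) = refl
sweep-step (suc t) (suc (suc p)) = sweep-step t p

sweep-hole : ∀ t → sweep t (double t) ≡ false
sweep-hole zero = refl
sweep-hole (suc t) = sweep-hole t

sweep-next : ∀ t → sweep t (suc (double t)) ≡ true
sweep-next zero = refl
sweep-next (suc t) = sweep-next t

sweep-next₂ : ∀ t → sweep t (suc (suc (double t))) ≡ true
sweep-next₂ zero = refl
sweep-next₂ (suc t) = sweep-next₂ t

sweep-even : ∀ t p → p ≤ double t → sweep t p ≡ true → parity p ≡ 0ℙ
sweep-even t zero _ _ = refl
sweep-even (suc t) (suc zero) _ ()
sweep-even (suc t) (suc (suc p)) (s≤s (s≤s p≤2t)) peg = sweep-even t p p≤2t peg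

sweep-count : ∀ t → pegCount {double t} (λ v → sweep t (toℕ v)) ≡ t
sweep-count zero = refl
sweep-count (suc t) = cong suc (sweep-count t)

sweep-count-odd : ∀ t → pegCount {suc (double t)} (λ v → sweep t (toℕ v)) ≡ t
sweep-count-odd zero = refl
sweep-count-odd (suc t) = cong suc (sweep-count-odd t)

sweep-count-lower : ∀ m t → m ≤ double t → m ≤ double (pegCount {m} (λ v → sweep t (toℕ v)))
sweep-count-lower zero t _ = z≤n
sweep-count-lower (suc zero) (suc t) _ = s≤s z≤n
sweep-count-lower (suc (suc m)) (suc t) (s≤s (s≤s m≤2t)) =
  s≤s (s≤s (sweep-count-lower m t m≤2t))

-- The last jump 0, 2t+1 → 2t that closes the sweep along a Hamiltonian cycle of length 2t+2.
closing : ℕ → ℕ → Bool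
closing t zero = false
closing t (suc zero) = false
closing t (suc (suc p)) = sweep t p

closing-step : ∀ s p → p < suc (suc (double (suc s))) → closing (suc s) p ≡
  (if p ≡ᵇ double (suc s) then true
   else if (p ≡ᵇ 0) ∨ (p ≡ᵇ suc (double (suc s))) then false else sweep (suc s) p)
closing-step s zero _ = refl
closing-step s (suc zero) _ = refl
closing-step s (suc (suc p)) (s≤s (s≤s p<2s+2))
  rewrite sweep-step s p | ≡ᵇ-≢ (ℕ.<⇒≢ p<2s+2) = refl

closing-even : ∀ t p → p ≤ suc (double t) → closing t p ≡ true → parity p ≡ 0ℙ
closing-even t (suc (suc p)) (s≤s p<2t) peg = sweep-even t p (ℕ.<⇒≤ p<2t) peg

-- Bipartite graphs with the Hamiltonian path 0, 1, …, N − 1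

module PathOrdered {M} (H : Graph (suc M)) (simple : IsSimpleGraph H) (bipartite : Bipartite H)
  (3≤M : 3 ≤ M)
  (path : ∀ p q → toℕ q ≡ suc (toℕ p) → Adjacent H p q)
  (cycle : parity (suc M) ≡ 0ℙ → Adjacent H (F.fromℕ M) F.zero) where

  adjacent-sym : ∀ {u v} → Adjacent H u v → Adjacent H v u
  adjacent-sym {u} {v} uv = trans (proj₁ simple v u) uv

  adjacent⇒≢ : ∀ {u v} → Adjacent H u v → u ≢ v
  adjacent⇒≢ {u} uv refl = true≢false (trans (sym uv) (proj₂ simple u))

  path⁻ : ∀ p q → toℕ q ≡ suc (toℕ p) → Adjacent H q p
  path⁻ p q q≡1+p = adjacent-sym (path p q q≡1+p)

  position : ∀ {k} → k < suc M → Σ[ q ∈ Fin (suc M) ] toℕ q ≡ k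
  position k<N = F.fromℕ< k<N , F.toℕ-fromℕ< k<N

  successor : ∀ (p r : Fin (suc M)) → toℕ p < toℕ r →
    Σ[ q ∈ Fin (suc M) ] toℕ q ≡ suc (toℕ p)
  successor p r p<r = position (ℕ.≤-<-trans p<r (F.toℕ<n r))

  predecessor : ∀ (p : Fin (suc M)) {k} → toℕ p ≡ suc k → Σ[ q ∈ Fin (suc M) ] toℕ q ≡ k
  predecessor (F.suc q) p≡1+k = F.inject₁ q , trans (F.toℕ-inject₁ q) (ℕ.suc-injective p≡1+k)

  colour : Fin (suc M) → Bool
  colour = proj₁ bipartite

  colour-position : ∀ m (p : Fin (suc M)) → toℕ p ≡ m →
    colour p ≡ flipBy (parity m) (colour F.zero)
  colour-position zero p p≡0 = cong colour (F.toℕ-injective p≡0)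
  colour-position (suc m) p p≡1+m with predecessor p p≡1+m
  ... | q , q≡m = begin
    colour p                                 ≡⟨ B.¬-not (≢-sym (proj₂ bipartite q p q~p)) ⟩
    not (colour q)                           ≡⟨ cong not (colour-position m q q≡m) ⟩
    not (flipBy (parity m) (colour F.zero))  ≡⟨ flipBy-suc m (colour F.zero) ⟨
    flipBy (parity (suc m)) (colour F.zero)  ∎
    where
    open ≡-Reasoning
    q~p : Adjacent H q p
    q~p = path q p (trans p≡1+m (cong suc (sym q≡m)))

  parity-adjacent : ∀ {u v} → Adjacent H u v → parity (toℕ u) ≢ parity (toℕ v)
  parity-adjacent {u} {v} uv pu≡pv = proj₂ bipartite u v uv (begin
    colour u                                 ≡⟨ colour-position _ u refl ⟩
    flipBy (parity (toℕ u)) (colour F.zero)  ≡⟨ cong (λ p → flipBy p (colour F.zero)) pu≡pv ⟩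
    flipBy (parity (toℕ v)) (colour F.zero)  ≡⟨ colour-position _ v refl ⟨
    colour v                                 ∎)
    where open ≡-Reasoning

  evenPegs⇒independent : ∀ {C} → (∀ v → C v ≡ true → parity (toℕ v) ≡ 0ℙ) → IsIndependent H C
  evenPegs⇒independent even x y Cx Cy =
    B.¬-not λ xy → parity-adjacent xy (trans (even x Cx) (sym (even y Cy)))

  independent⇒sparse : ∀ {S} → IsIndependent H S → Sparse S
  independent⇒sparse ind i j j≡1+i Si =
    B.¬-not λ Sj → true≢false (trans (sym (path i j j≡1+i)) (ind i j Si Sj))

  -- Next to two adjacent pegs of a stuck configuration there is no hole; walking along the path
  -- towards a hole thus gives a contradiction.
  module _ {C : Config (suc M)} (stuck : ¬ JumpAvailable H C) where

    peg≢hole : ∀ {u v} → C u ≡ true → C v ≡ false → u ≢ v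
    peg≢hole Cu Cv refl = true≢false (trans (sym Cu) Cv)

    forced-peg : ∀ {y p q} → C y ≡ true → Adjacent H y p → C p ≡ true → Adjacent H p q →
      C q ≡ true
    forced-peg {q = q} Cy yp Cp pq with C q in Cq
    ... | true = refl
    ... | false = ⊥-elim (stuck (_ , _ , q , (yp , pq , peg≢hole Cy Cq) , Cy , Cp , Cq))

    walk-up : ∀ d {y p r} → C y ≡ true → Adjacent H y p → C p ≡ true → C r ≡ false →
      toℕ r ≡ suc (toℕ p + d) → ⊥
    walk-up zero {p = p} {r} Cy yp Cp Cr r≡ =
      peg≢hole (forced-peg Cy yp Cp (path p r (trans r≡ (cong suc (ℕ.+-identityʳ _))))) Cr refl
    walk-up (suc d) {p = p} {r} Cy yp Cp Cr r≡ =
      let q , q≡ = successor p r (subst (toℕ p <_) (sym r≡) (s≤s (ℕ.m≤m+n (toℕ p) (suc d))))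
          pq = path p q q≡
      in walk-up d Cp pq (forced-peg Cy yp Cp pq) Cr
           (trans r≡ (cong suc (trans (ℕ.+-suc _ d) (cong (_+ d) (sym q≡)))))

    walk-down : ∀ d {y p r} → C y ≡ true → Adjacent H y p → C p ≡ true → C r ≡ false →
      toℕ p ≡ suc (toℕ r + d) → ⊥
    walk-down zero {p = p} {r} Cy yp Cp Cr p≡ =
      peg≢hole (forced-peg Cy yp Cp (path⁻ r p (trans p≡ (cong suc (ℕ.+-identityʳ _))))) Cr refl
    walk-down (suc d) {p = p} {r} Cy yp Cp Cr p≡ =
      let q , q≡ = predecessor p (trans p≡ (cong suc (ℕ.+-suc _ d)))
          pq = path⁻ q p (trans p≡ (cong suc (trans (ℕ.+-suc _ d) (sym q≡))))
      in walk-down d Cp pq (forced-peg Cy yp Cp pq) Cr q≡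

    stuck⇒independent : ∀ {u} → C u ≡ false → IsIndependent H C
    stuck⇒independent {u} Cu x y Cx Cy = B.¬-not λ xy → no-jump-towards-hole xy
      where
      no-jump-towards-hole : Adjacent H x y → ⊥
      no-jump-towards-hole xy with ℕ.<-cmp (toℕ y) (toℕ u)
      ... | tri< y<u _ _ = let d , eq = ℕ.m≤n⇒∃[o]m+o≡n y<u in walk-up d Cx xy Cy Cu (sym eq)
      ... | tri≈ _ y≡u _ = peg≢hole Cy Cu (F.toℕ-injective y≡u)
      ... | tri> _ _ u<y =
        let d , eq = ℕ.m≤n⇒∃[o]m+o≡n u<y in walk-down d Cx xy Cy Cu (sym eq)

  jump-into-start : ∀ {a b h} → Adjacent H a b → Adjacent H b h → toℕ a ≢ toℕ h → toℕ b ≢ toℕ h →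
    JumpAvailable H (start h)
  jump-into-start {a} {b} {h} ab bh a≢h b≢h =
    a , b , h , (ab , bh , a≢h ∘ cong toℕ) ,
    start-peg (a≢h ∘ cong toℕ) , start-peg (b≢h ∘ cong toℕ) , start-hole h

  jump-from-above : ∀ h → suc (suc (toℕ h)) < suc M → JumpAvailable H (start h)
  jump-from-above h h+2<N =
    let b , b≡ = position (ℕ.<-trans (ℕ.n<1+n _) h+2<N)
        a , a≡ = position h+2<N
    in jump-into-start (path⁻ b a (trans a≡ (cong suc (sym b≡)))) (path⁻ h b b≡)
         (ℕ.>⇒≢ (subst (toℕ h <_) (sym a≡) (ℕ.m<n⇒m<1+n (ℕ.n<1+n _))))
         (ℕ.>⇒≢ (subst (toℕ h <_) (sym b≡) (ℕ.n<1+n _)))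

  start-jumpAvailable : ∀ h → JumpAvailable H (start h)
  start-jumpAvailable h with toℕ h in h≡
  ... | zero = jump-from-above h (subst (λ n → 2 + n < suc M) (sym h≡) (ℕ.m≤n⇒m≤1+n 3≤M))
  ... | suc zero = jump-from-above h (subst (λ n → 2 + n < suc M) (sym h≡) (s≤s 3≤M))
  ... | suc (suc k) =
    let b , b≡ = predecessor h h≡
        a , a≡ = predecessor b b≡
    in jump-into-start (path a b (trans b≡ (cong suc (sym a≡))))
         (path b h (trans h≡ (cong suc (sym b≡))))
         (ℕ.<⇒≢ (subst₂ _<_ (sym a≡) (sym h≡) (ℕ.m<n⇒m<1+n (ℕ.n<1+n k))))
         (ℕ.<⇒≢ (subst₂ _<_ (sym b≡) (sym h≡) (ℕ.n<1+n (suc k))))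

  terminal-count : ∀ {T} → IsTerminalState H T → double (pegCount T) < suc M
  terminal-count {T} ((h , play) , stuck) with star-last play
  ... | inj₁ refl = ⊥-elim (stuck (start-jumpAvailable h))
  ... | inj₂ (B , x , y , z , ((xy , yz , x≢z) , _) , T≗) =
    sparse-count-oppositeHoles T (independent⇒sparse independent) wrap x y Tx Ty (parity-adjacent xy)
    where
    Tx : T x ≡ false
    Tx = trans (T≗ x) (afterJump-source B y x≢z)
    Ty : T y ≡ false
    Ty = trans (T≗ y) (afterJump-middle B x (adjacent⇒≢ yz))
    independent : IsIndependent H T
    independent = stuck⇒independent stuck Tx
    wrap : parity (suc M) ≡ 0ℙ → T F.zero ≡ true → T (F.fromℕ M) ≡ false
    wrap even T₀ =
      B.¬-not λ Tlast → true≢false (trans (sym (cycle even)) (independent _ _ Tlast T₀))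

  sweep-jump : ∀ t (C : Config (suc M)) → (∀ v → C v ≡ sweep t (toℕ v)) →
    suc (suc (double t)) < suc M → Jump H C (λ v → sweep (suc t) (toℕ v))
  sweep-jump t C C≗ 2t+2<N
    with position 2t+2<N | position (ℕ.<-trans (ℕ.n<1+n _) 2t+2<N)
       | position (ℕ.<-trans (ℕ.m<n⇒m<1+n (ℕ.n<1+n _)) 2t+2<N)
  ... | x , x≡ | y , y≡ | z , z≡ =
    x , y , z ,
    ((path⁻ y x (trans x≡ (cong suc (sym y≡))) , path⁻ z y (trans y≡ (cong suc (sym z≡))) ,
      λ x≡z → ℕ.>⇒≢ (ℕ.m<n⇒m<1+n (ℕ.n<1+n _)) (trans (sym x≡) (trans (cong toℕ x≡z) z≡))) ,
     peg x≡ (sweep-next₂ t) , peg y≡ (sweep-next t) , peg z≡ (sweep-hole t)) ,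
    after
    where
    peg : ∀ {u k b} → toℕ u ≡ k → sweep t k ≡ b → C u ≡ b
    peg {u} u≡k sweep≡b = trans (C≗ u) (trans (cong (sweep t) u≡k) sweep≡b)
    after : ∀ v → sweep (suc t) (toℕ v) ≡ afterJump C x y z v
    after v
      rewrite ⌊≟⌋≡toℕ-≡ᵇ v z | ⌊≟⌋≡toℕ-≡ᵇ v x | ⌊≟⌋≡toℕ-≡ᵇ v y | x≡ | y≡ | z≡ | C≗ v =
      sweep-step t (toℕ v)

  start≗sweep : ∀ (v : Fin (suc M)) → start F.zero v ≡ sweep 0 (toℕ v)
  start≗sweep F.zero = refl
  start≗sweep (F.suc v) = refl

  sweep-reachable : ∀ t → double (suc t) < suc M →
    Star (Jump H) (start F.zero) (λ v → sweep (suc t) (toℕ v))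
  sweep-reachable zero 2<N = sweep-jump 0 (start F.zero) start≗sweep 2<N ◅ ε
  sweep-reachable (suc t) 2t+4<N =
    sweep-reachable t (ℕ.<-trans (ℕ.n<1+n _) (ℕ.<-trans (ℕ.n<1+n _) 2t+4<N)) ◅◅
    (sweep-jump (suc t) _ (λ _ → refl) 2t+4<N ◅ ε)

  closing-jump : ∀ s → suc M ≡ double (suc (suc s)) →
    Jump H (λ v → sweep (suc s) (toℕ v)) (λ v → closing (suc s) (toℕ v))
  closing-jump s N≡2s+4
    with position (subst (double (suc s) <_) (sym N≡2s+4) (ℕ.m<n⇒m<1+n (ℕ.n<1+n _)))
  ... | z , z≡ =
    F.zero , last , z ,
    ((adjacent-sym (cycle even) , path⁻ z last (trans last≡ (cong suc (sym z≡))) ,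
      λ 0≡z → ℕ.0≢1+n (trans (cong toℕ 0≡z) z≡)) ,
     refl , trans (cong (sweep (suc s)) last≡) (sweep-next (suc s)) ,
     trans (cong (sweep (suc s)) z≡) (sweep-hole (suc s))) ,
    after
    where
    even : parity (suc M) ≡ 0ℙ
    even = trans (cong parity N≡2s+4) (parity-double (suc (suc s)))
    last : Fin (suc M)
    last = F.fromℕ M
    last≡ : toℕ last ≡ suc (double (suc s))
    last≡ = trans (F.toℕ-fromℕ M) (ℕ.suc-injective N≡2s+4)
    after : ∀ v →
      closing (suc s) (toℕ v) ≡ afterJump (λ v → sweep (suc s) (toℕ v)) F.zero last z v
    after v
      rewrite ⌊≟⌋≡toℕ-≡ᵇ v z | ⌊≟⌋≡toℕ-≡ᵇ v F.zero | ⌊≟⌋≡toℕ-≡ᵇ v last | last≡ | z≡ =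
      closing-step s (toℕ v) (subst (toℕ v <_) N≡2s+4 (F.toℕ<n v))

  sweep-terminal : ∀ t → suc M ≡ suc (double (suc t)) →
    Σ[ T ∈ Config (suc M) ] IsTerminalState H T × pegCount T ≡ suc t
  sweep-terminal t N≡2t+3 =
    T , ((F.zero , sweep-reachable t (subst (double (suc t) <_) (sym N≡2t+3) (ℕ.n<1+n _))) ,
         independent⇒stuck (evenPegs⇒independent even)) ,
    trans (pegCount-reindex N≡2t+3 (sweep (suc t))) (sweep-count-odd (suc t))
    where
    T : Config (suc M)
    T v = sweep (suc t) (toℕ v)
    even : ∀ v → T v ≡ true → parity (toℕ v) ≡ 0ℙ
    even v = sweep-even (suc t) (toℕ v) (s≤s⁻¹ (subst (toℕ v <_) N≡2t+3 (F.toℕ<n v)))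

  closing-terminal : ∀ s → suc M ≡ double (suc (suc s)) →
    Σ[ T ∈ Config (suc M) ] IsTerminalState H T × pegCount T ≡ suc s
  closing-terminal s N≡2s+4 =
    T , ((F.zero , sweep-reachable s 2s+2<N ◅◅ (closing-jump s N≡2s+4 ◅ ε)) ,
         independent⇒stuck (evenPegs⇒independent even)) ,
    trans (pegCount-reindex N≡2s+4 (closing (suc s))) (sweep-count (suc s))
    where
    T : Config (suc M)
    T v = closing (suc s) (toℕ v)
    2s+2<N : double (suc s) < suc M
    2s+2<N = subst (double (suc s) <_) (sym N≡2s+4) (ℕ.m<n⇒m<1+n (ℕ.n<1+n _))
    even : ∀ v → T v ≡ true → parity (toℕ v) ≡ 0ℙ
    even v = closing-even (suc s) (toℕ v) (s≤s⁻¹ (subst (toℕ v <_) N≡2s+4 (F.toℕ<n v)))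

  terminal-witness :
    Σ[ T ∈ Config (suc M) ] IsTerminalState H T × suc M ≤ suc (suc (double (pegCount T)))
  terminal-witness with halve (suc M)
  ... | zero , inj₁ ()
  ... | zero , inj₂ N≡1 with () ← subst (3 ≤_) (ℕ.suc-injective N≡1) 3≤M
  ... | suc zero , inj₁ N≡2 with s≤s () ← subst (3 ≤_) (ℕ.suc-injective N≡2) 3≤M
  ... | suc t , inj₂ N≡2t+3 with sweep-terminal t N≡2t+3
  ...   | T , T-terminal , count = T , T-terminal ,
    subst (λ c → suc M ≤ suc (suc (double c))) (sym count) (ℕ.m≤n⇒m≤1+n (ℕ.≤-reflexive N≡2t+3))
  terminal-witness | suc (suc s) , inj₁ N≡2s+4 with closing-terminal s N≡2s+4
  ...   | T , T-terminal , count = T , T-terminal ,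
    subst (λ c → suc M ≤ suc (suc (double c))) (sym count) (ℕ.≤-reflexive N≡2s+4)

  -- Below 2t, the pegs of sweep t are exactly the even positions.
  evens : Config (suc M)
  evens v = sweep (suc M) (toℕ v)

  evens-independent : IsIndependent H evens
  evens-independent = evenPegs⇒independent λ v →
    sweep-even (suc M) (toℕ v)
      (ℕ.≤-trans (F.toℕ≤pred[n] v) (ℕ.≤-trans (≤double M) (ℕ.m≤n⇒m≤1+n (ℕ.n≤1+n _))))

  evens-count : suc M ≤ double (pegCount evens)
  evens-count = sweep-count-lower (suc M) (suc M) (≤double (suc M))

  foolsNumber≡α-1 : ∀ a → IsIndependenceNumber H a → IsFoolsSolitaireNumber H (a ∸ 1)
  foolsNumber≡α-1 a ((S , S-independent , refl) , α-max) with terminal-witness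
  ... | T₀ , T₀-terminal , N≤2T₀+2 =
    (T₀ , T₀-terminal , ℕ.≤-antisym (bounded _ (T₀ , T₀-terminal , refl)) T₀-large) , bounded
    where
    N≤2α : suc M ≤ double (pegCount S)
    N≤2α = ℕ.≤-trans evens-count (double-mono-≤ (α-max _ (evens , evens-independent , refl)))
    bounded : ∀ j → (Σ[ T ∈ Config (suc M) ] IsTerminalState H T × pegCount T ≡ j) →
      j ≤ pegCount S ∸ 1
    bounded j (T , T-terminal , refl) =
      1+double≤double⇒≤∸1 (ℕ.≤-trans (terminal-count T-terminal) N≤2α)
    T₀-large : pegCount S ∸ 1 ≤ pegCount T₀
    T₀-large = ℕ.∸-monoˡ-≤ 1 (double≤1+double⇒≤
      (ℕ.≤-trans (sparse-count S (independent⇒sparse S-independent)) (s≤s N≤2T₀+2)))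

-- Hamiltonian paths and cycles of grids

Neighbours : ℕ → ℕ → Set
Neighbours m n = suc m ≡ n ⊎ suc n ≡ m

Neighbours-suc : ∀ {m n} → Neighbours m n → Neighbours (suc m) (suc n)
Neighbours-suc (inj₁ e) = inj₁ (cong suc e)
Neighbours-suc (inj₂ e) = inj₂ (cong suc e)

Neighbours-∸ : ∀ {b m n} → m ≤ b → n ≤ b → Neighbours m n → Neighbours (b ∸ m) (b ∸ n)
Neighbours-∸ m≤b n≤b (inj₁ refl) = inj₂ (sym (ℕ.+-∸-assoc 1 n≤b))
Neighbours-∸ m≤b n≤b (inj₂ refl) = inj₁ (sym (ℕ.+-∸-assoc 1 m≤b))

Neighbours-opposite : ∀ {b′} {h h′ : Fin (suc b′)} → Neighbours (toℕ h) (toℕ h′) →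
  Neighbours (toℕ (F.opposite h)) (toℕ (F.opposite h′))
Neighbours-opposite {h = h} {h′} nb =
  subst₂ Neighbours (sym (F.opposite-prop h)) (sym (F.opposite-prop h′))
    (Neighbours-∸ (F.toℕ≤pred[n] h) (F.toℕ≤pred[n] h′) nb)

GridAdjacent : ∀ {a b} → Fin a × Fin b → Fin a × Fin b → Set
GridAdjacent (i , h) (i′ , h′) =
  (i ≡ i′ × Neighbours (toℕ h) (toℕ h′)) ⊎ (h ≡ h′ × Neighbours (toℕ i) (toℕ i′))

GridAdjacent-swap : ∀ {a b} {u v : Fin a × Fin b} →
  GridAdjacent u v → GridAdjacent (swap u) (swap v)
GridAdjacent-swap (inj₁ adj) = inj₂ adj
GridAdjacent-swap (inj₂ adj) = inj₁ adj

record GridPath (a b : ℕ) : Set where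
  field
    cell : Fin (a * b) → Fin a × Fin b
    cell-injective : ∀ p q → cell p ≡ cell q → p ≡ q
    cell-step : ∀ p q → toℕ q ≡ suc (toℕ p) → GridAdjacent (cell p) (cell q)

open GridPath

StartsAtOrigin : ∀ {a b} → GridPath a b → Set
StartsAtOrigin T = ∀ p → toℕ p ≡ 0 → toℕ (proj₁ (cell T p)) ≡ 0 × toℕ (proj₂ (cell T p)) ≡ 0

Closes : ∀ {a b} → GridPath a b → Set
Closes {a} {b} T =
  ∀ p q → toℕ p ≡ 0 → suc (toℕ q) ≡ a * b → GridAdjacent (cell T q) (cell T p)

data SplitView (m : ℕ) {n : ℕ} : Fin (m + n) → Set where
  top : (x : Fin m) → SplitView m (x ↑ˡ n)
  bottom : (y : Fin n) → SplitView m (m ↑ʳ y)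

splitView : ∀ m {n} (p : Fin (m + n)) → SplitView m p
splitView m p with splitAt m p in eq
... | inj₁ x rewrite sym (F.splitAt⁻¹-↑ˡ eq) = top x
... | inj₂ y rewrite sym (F.splitAt⁻¹-↑ʳ eq) = bottom y

transpose : ∀ {a b} → GridPath a b → GridPath b a
transpose {a} {b} T = record
  { cell = swap ∘ cell T ∘ F.cast b*a≡a*b
  ; cell-injective = λ p q e → cast-injective (cell-injective T _ _ (cong swap e))
  ; cell-step = λ p q q≡1+p → GridAdjacent-swap (cell-step T _ _
      (trans (F.toℕ-cast b*a≡a*b q) (trans q≡1+p (cong suc (sym (F.toℕ-cast b*a≡a*b p))))))
  }
  where
  b*a≡a*b : b * a ≡ a * b
  b*a≡a*b = ℕ.*-comm b a
  cast-injective : ∀ {p q} → F.cast b*a≡a*b p ≡ F.cast b*a≡a*b q → p ≡ q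
  cast-injective {p} {q} e = F.toℕ-injective
    (trans (sym (F.toℕ-cast b*a≡a*b p)) (trans (cong toℕ e) (F.toℕ-cast b*a≡a*b q)))

transpose-origin : ∀ {a b} (T : GridPath a b) → StartsAtOrigin T → StartsAtOrigin (transpose T)
transpose-origin {a} {b} T T-origin p p≡0 =
  swap (T-origin (F.cast (ℕ.*-comm b a) p) (trans (F.toℕ-cast (ℕ.*-comm b a) p) p≡0))

transpose-closes : ∀ {a b} (T : GridPath a b) → Closes T → Closes (transpose T)
transpose-closes {a} {b} T T-closes p q p≡0 q≡last = GridAdjacent-swap (T-closes _ _
  (trans (F.toℕ-cast (ℕ.*-comm b a) p) p≡0)
  (trans (cong suc (F.toℕ-cast (ℕ.*-comm b a) q)) (trans q≡last (ℕ.*-comm b a))))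

opposite-injective : ∀ {n} {h h′ : Fin n} → F.opposite h ≡ F.opposite h′ → h ≡ h′
opposite-injective {h = h} {h′} e =
  trans (sym (F.opposite-involutive h)) (trans (cong F.opposite e) (F.opposite-involutive h′))

-- Row 0 from left to right, then T shifted one row down and mirrored left–right.
module Stack {a b′ : ℕ} (T : GridPath a (suc b′)) (T-origin : StartsAtOrigin T) where

  below : Fin (a * suc b′) → Fin (suc a) × Fin (suc b′)
  below y = F.suc (proj₁ (cell T y)) , F.opposite (proj₂ (cell T y))

  stackCell : Fin (suc a * suc b′) → Fin (suc a) × Fin (suc b′)
  stackCell p = [ (λ x → F.zero , x) , below ]′ (splitAt (suc b′) p)

  stackCell-top : ∀ x → stackCell (x ↑ˡ (a * suc b′)) ≡ (F.zero , x)
  stackCell-top x rewrite F.splitAt-↑ˡ (suc b′) x (a * suc b′) = refl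

  stackCell-bottom : ∀ y → stackCell (suc b′ ↑ʳ y) ≡ below y
  stackCell-bottom y rewrite F.splitAt-↑ʳ (suc b′) (a * suc b′) y = refl

  below-injective : ∀ y y′ → below y ≡ below y′ → y ≡ y′
  below-injective y y′ e =
    cell-injective T y y′
      (cong₂ _,_ (F.suc-injective (cong proj₁ e)) (opposite-injective (cong proj₂ e)))

  below-adjacent : ∀ {y y′} →
    GridAdjacent (cell T y) (cell T y′) → GridAdjacent (below y) (below y′)
  below-adjacent (inj₁ (i≡i′ , nb)) = inj₁ (cong F.suc i≡i′ , Neighbours-opposite nb)
  below-adjacent (inj₂ (h≡h′ , nb)) = inj₂ (cong F.opposite h≡h′ , Neighbours-suc nb)

  stackCell-injective : ∀ p q → stackCell p ≡ stackCell q → p ≡ q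
  stackCell-injective p q e with splitView (suc b′) p | splitView (suc b′) q
  ... | top x | top x′ =
    cong (_↑ˡ _) (cong proj₂ (trans (sym (stackCell-top x)) (trans e (stackCell-top x′))))
  ... | top x | bottom y′ = ⊥-elim (F.0≢1+n
    (cong proj₁ (trans (sym (stackCell-top x)) (trans e (stackCell-bottom y′)))))
  ... | bottom y | top x′ = ⊥-elim (F.0≢1+n
    (cong proj₁ (trans (sym (stackCell-top x′)) (trans (sym e) (stackCell-bottom y)))))
  ... | bottom y | bottom y′ =
    cong (suc b′ ↑ʳ_)
      (below-injective y y′ (trans (sym (stackCell-bottom y)) (trans e (stackCell-bottom y′))))

  -- The top row ends at column b′, right above the origin of T, which below reflects to column b′.
  junction : ∀ x y → suc b′ + toℕ y ≡ suc (toℕ x) → GridAdjacent (F.zero , x) (below y)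
  junction x y e = inj₂ (F.toℕ-injective (begin
      toℕ x                                    ≡⟨ x≡b′ ⟩
      b′                                       ≡⟨ cong (b′ ∸_) (proj₂ (T-origin y y≡0)) ⟨
      b′ ∸ toℕ (proj₂ (cell T y))              ≡⟨ F.opposite-prop (proj₂ (cell T y)) ⟨
      toℕ (F.opposite (proj₂ (cell T y)))      ∎) ,
    inj₁ (cong suc (sym (proj₁ (T-origin y y≡0)))))
    where
    open ≡-Reasoning
    y≡0 : toℕ y ≡ 0
    y≡0 = ℕ.n≤0⇒n≡0 (ℕ.+-cancelˡ-≤ b′ (toℕ y) 0 (ℕ.≤-trans (ℕ.≤-reflexive (ℕ.suc-injective e))
      (ℕ.≤-trans (F.toℕ≤pred[n] x) (ℕ.≤-reflexive (sym (ℕ.+-identityʳ b′))))))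
    x≡b′ : toℕ x ≡ b′
    x≡b′ = trans (ℕ.suc-injective (sym e)) (trans (cong (b′ +_) y≡0) (ℕ.+-identityʳ b′))

  top<bottom : ∀ x (y : Fin (a * suc b′)) → toℕ (x ↑ˡ (a * suc b′)) < toℕ (suc b′ ↑ʳ y)
  top<bottom x y rewrite F.toℕ-↑ˡ x (a * suc b′) | F.toℕ-↑ʳ (suc b′) y =
    ℕ.<-≤-trans (F.toℕ<n x) (ℕ.m≤m+n (suc b′) (toℕ y))

  stackCell-step : ∀ p q → toℕ q ≡ suc (toℕ p) → GridAdjacent (stackCell p) (stackCell q)
  stackCell-step p q q≡1+p with splitView (suc b′) p | splitView (suc b′) q
  ... | top x | top x′ rewrite stackCell-top x | stackCell-top x′ =
    inj₁ (refl , inj₁ (sym (trans (sym (F.toℕ-↑ˡ x′ _)) (trans q≡1+p (cong suc (F.toℕ-↑ˡ x _))))))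
  ... | top x | bottom y rewrite stackCell-top x | stackCell-bottom y =
    junction x y (trans (sym (F.toℕ-↑ʳ (suc b′) y)) (trans q≡1+p (cong suc (F.toℕ-↑ˡ x _))))
  ... | bottom y | top x′ =
    ⊥-elim (ℕ.<-asym (top<bottom x′ y) (subst (toℕ (suc b′ ↑ʳ y) <_) (sym q≡1+p) (ℕ.n<1+n _)))
  ... | bottom y | bottom y′ rewrite stackCell-bottom y | stackCell-bottom y′ =
    below-adjacent (cell-step T y y′ (ℕ.+-cancelˡ-≡ (suc b′) _ _ (begin
      suc b′ + toℕ y′           ≡⟨ F.toℕ-↑ʳ (suc b′) y′ ⟨
      toℕ (suc b′ ↑ʳ y′)        ≡⟨ q≡1+p ⟩
      suc (toℕ (suc b′ ↑ʳ y))   ≡⟨ cong suc (F.toℕ-↑ʳ (suc b′) y) ⟩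
      suc (suc b′ + toℕ y)      ≡⟨ ℕ.+-suc (suc b′) (toℕ y) ⟨
      suc b′ + suc (toℕ y)      ∎)))
    where open ≡-Reasoning

  path : GridPath (suc a) (suc b′)
  path = record
    { cell = stackCell ; cell-injective = stackCell-injective ; cell-step = stackCell-step }

  origin : StartsAtOrigin path
  origin F.zero _ = refl , refl

snake : ∀ b′ a → GridPath a (suc b′)
snake-origin : ∀ b′ a → StartsAtOrigin (snake b′ a)

snake b′ zero = record { cell = λ () ; cell-injective = λ () ; cell-step = λ () }
snake b′ (suc a) = Stack.path (snake b′ a) (snake-origin b′ a)

snake-origin b′ zero ()
snake-origin b′ (suc a) = Stack.origin (snake b′ a) (snake-origin b′ a)

endColumn : ℕ → Parity → ℕ
endColumn b′ 0ℙ = b′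
endColumn b′ 1ℙ = 0

endColumn-suc : ∀ b′ n → b′ ∸ endColumn b′ (parity n) ≡ endColumn b′ (parity (suc n))
endColumn-suc b′ zero = ℕ.n∸n≡0 b′
endColumn-suc b′ (suc zero) = refl
endColumn-suc b′ (suc (suc n)) = endColumn-suc b′ n

↑ˡ-notLast : ∀ {b′ n} (x : Fin (suc b′)) → suc (toℕ (x ↑ˡ suc n)) ≢ suc b′ + suc n
↑ˡ-notLast {b′} {n} x = ℕ.<⇒≢ (ℕ.≤-<-trans
  (subst (_≤ suc b′) (cong suc (sym (F.toℕ-↑ˡ x _))) (s≤s (F.toℕ≤pred[n] x)))
  (ℕ.m<m+n (suc b′) (s≤s z≤n)))

↑ʳ-last : ∀ m {n} (y : Fin n) {k} → suc (toℕ (m ↑ʳ y)) ≡ m + k → suc (toℕ y) ≡ k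
↑ʳ-last m y e =
  ℕ.+-cancelˡ-≡ m _ _ (trans (ℕ.+-suc m _) (trans (cong suc (sym (F.toℕ-↑ʳ m y))) e))

snake-end : ∀ b′ a p → suc (toℕ p) ≡ suc a * suc b′ →
  toℕ (proj₁ (cell (snake b′ (suc a)) p)) ≡ a ×
  toℕ (proj₂ (cell (snake b′ (suc a)) p)) ≡ endColumn b′ (parity a)
snake-end b′ a p p≡last with splitView (suc b′) p
snake-end b′ zero p p≡last | top x
  rewrite Stack.stackCell-top (snake b′ zero) (snake-origin b′ zero) x =
  refl , trans (ℕ.suc-injective (trans (cong suc (sym (F.toℕ-↑ˡ x 0))) p≡last)) (ℕ.+-identityʳ b′)
snake-end b′ (suc a) p p≡last | top x = ⊥-elim (↑ˡ-notLast x p≡last)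
snake-end b′ (suc a) p p≡last | bottom y
  rewrite Stack.stackCell-bottom (snake b′ (suc a)) (snake-origin b′ (suc a)) y
  with snake-end b′ a y (↑ʳ-last (suc b′) y p≡last)
... | row≡a , column≡end =
  cong suc row≡a ,
  trans (F.opposite-prop (proj₂ (cell (snake b′ (suc a)) y)))
        (trans (cong (b′ ∸_) column≡end) (endColumn-suc b′ a))

module _ (a′ b′ : ℕ) where
  private
    S : GridPath (suc b′) (suc a′)
    S = snake a′ (suc b′)
    Sᵀ-origin : StartsAtOrigin (transpose S)
    Sᵀ-origin = transpose-origin S (snake-origin a′ (suc b′))

  cycleTour : GridPath (suc (suc a′)) (suc b′)
  cycleTour = Stack.path (transpose S) Sᵀ-origin

  cycleTour-end : parity (suc b′) ≡ 0ℙ → ∀ q → suc (toℕ q) ≡ suc (suc a′) * suc b′ →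
    toℕ (proj₁ (cell cycleTour q)) ≡ 1 × toℕ (proj₂ (cell cycleTour q)) ≡ 0
  cycleTour-end even q q≡last with splitView (suc b′) q
  ... | top x = ⊥-elim (↑ˡ-notLast x q≡last)
  ... | bottom y rewrite Stack.stackCell-bottom (transpose S) Sᵀ-origin y
    with snake-end a′ b′ (F.cast (ℕ.*-comm (suc a′) (suc b′)) y)
           (trans (cong suc (F.toℕ-cast _ y))
                  (trans (↑ʳ-last (suc b′) y q≡last) (ℕ.*-comm (suc a′) (suc b′))))
  ... | row≡b′ , column≡end =
    cong suc (trans column≡end (cong (endColumn a′) (parity-pred b′ even))) ,
    trans (F.opposite-prop (proj₁ (cell S (F.cast (ℕ.*-comm (suc a′) (suc b′)) y))))
      (trans (cong (b′ ∸_) row≡b′) (ℕ.n∸n≡0 b′))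

  cycleTour-closes : parity (suc b′) ≡ 0ℙ → Closes cycleTour
  cycleTour-closes even F.zero q _ q≡last with cycleTour-end even q q≡last
  ... | row≡1 , column≡0 = inj₂ (F.toℕ-injective column≡0 , inj₂ (sym row≡1))

gridTour : ∀ n′ k′ → Σ[ T ∈ GridPath (suc (suc n′)) (suc (suc k′)) ]
  (parity (suc (suc n′) * suc (suc k′)) ≡ 0ℙ → Closes T)
gridTour n′ k′ with parity k′ in k-parity | parity n′ in n-parity
... | 0ℙ | _ = cycleTour n′ (suc k′) , λ _ → cycleTour-closes n′ (suc k′) k-parity
... | 1ℙ | 0ℙ = transpose (cycleTour k′ (suc n′)) ,
  λ _ → transpose-closes (cycleTour k′ (suc n′)) (cycleTour-closes k′ (suc n′) n-parity)
... | 1ℙ | 1ℙ = snake (suc k′) (suc (suc n′)) , λ even → ⊥-elim (ℙ.p≢p⁻¹ 0ℙ (begin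
  0ℙ                                    ≡⟨ even ⟨
  parity (suc (suc n′) * suc (suc k′))  ≡⟨ ℙ.*-homo-* (suc (suc n′)) (suc (suc k′)) ⟩
  parity n′ ℙ* parity k′                ≡⟨ cong₂ _ℙ*_ n-parity k-parity ⟩
  1ℙ                                    ∎))
  where open ≡-Reasoning

-- Products with a path

module _ {n k} (G : Graph n) (K : Graph k) where

  quotRem-combine : ∀ g h → F.quotRem {n} k (combine g h) ≡ (h , g)
  quotRem-combine g h = cong swap (F.remQuot-combine {n} {k} g h)

  □-combine : ∀ g h g′ h′ →
    (G □ K) (combine g h) (combine g′ h′) ≡ (⌊ g ≟ g′ ⌋ ∧ K h h′) ∨ (⌊ h ≟ h′ ⌋ ∧ G g g′)
  □-combine g h g′ h′ rewrite quotRem-combine g h | quotRem-combine g′ h′ = refl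

  □-adjacentʳ : ∀ g {h h′} → Adjacent K h h′ → Adjacent (G □ K) (combine g h) (combine g h′)
  □-adjacentʳ g {h} {h′} hh′ rewrite □-combine g h g h′ | ⌊≟⌋-refl g | hh′ = refl

  □-adjacentˡ : ∀ {g g′} h → Adjacent G g g′ → Adjacent (G □ K) (combine g h) (combine g′ h)
  □-adjacentˡ {g} {g′} h gg′ rewrite □-combine g h g′ h | ⌊≟⌋-refl h | gg′ = B.∨-zeroʳ _

  □-adjacent-cases : ∀ {g h g′ h′} → Adjacent (G □ K) (combine g h) (combine g′ h′) →
    (g ≡ g′ × Adjacent K h h′) ⊎ (h ≡ h′ × Adjacent G g g′)
  □-adjacent-cases {g} {h} {g′} {h′} adj rewrite □-combine g h g′ h′ with g ≟ g′ | h ≟ h′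
  ... | yes g≡g′ | no _ = inj₁ (g≡g′ , trans (sym (B.∨-identityʳ _)) adj)
  ... | no _ | yes h≡h′ = inj₂ (h≡h′ , adj)
  ... | yes g≡g′ | yes h≡h′ with K h h′ in hh′
  ...   | true = inj₁ (g≡g′ , refl)
  ...   | false = inj₂ (h≡h′ , adj)

  □-simple : IsSimpleGraph G → IsSimpleGraph K → IsSimpleGraph (G □ K)
  □-simple (G-sym , G-irr) (K-sym , K-irr) = □-sym , □-irr
    where
    □-sym : ∀ u v → (G □ K) u v ≡ (G □ K) v u
    □-sym u v with F.quotRem {n} k u | F.quotRem {n} k v
    ... | h , g | h′ , g′ =
      cong₂ _∨_ (cong₂ _∧_ (⌊≟⌋-sym g g′) (K-sym h h′)) (cong₂ _∧_ (⌊≟⌋-sym h h′) (G-sym g g′))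
    □-irr : ∀ u → (G □ K) u u ≡ false
    □-irr u with F.quotRem {n} k u
    ... | h , g rewrite ⌊≟⌋-refl g | ⌊≟⌋-refl h | K-irr h | G-irr g = refl

  □-bipartite : Bipartite G → Bipartite K → Bipartite (G □ K)
  □-bipartite (cG , cG-proper) (cK , cK-proper) = colour , proper
    where
    colour : Fin (n * k) → Bool
    colour w = cG (proj₁ (remQuot {n} k w)) xor cK (proj₂ (remQuot {n} k w))
    colour-combine : ∀ g h → colour (combine g h) ≡ cG g xor cK h
    colour-combine g h rewrite quotRem-combine g h = refl
    proper : ∀ u v → Adjacent (G □ K) u v → colour u ≢ colour v
    proper u v adj with F.combine-surjective {n} {k} u | F.combine-surjective {n} {k} v
    ... | g , h , refl | g′ , h′ , refl rewrite colour-combine g h | colour-combine g′ h′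
      with □-adjacent-cases adj
    ... | inj₁ (refl , hh′) = xor-≢ʳ (cG g) (cK-proper h h′ hh′)
    ... | inj₂ (refl , gg′) = xor-≢ˡ (cK h) (cG-proper g g′ gg′)

PathGraph-neighbours : ∀ {k} {h h′ : Fin k} →
  Neighbours (toℕ h) (toℕ h′) → Adjacent (PathGraph k) h h′
PathGraph-neighbours (inj₁ 1+h≡h′) rewrite ≡ᵇ-≡ (sym 1+h≡h′) = refl
PathGraph-neighbours (inj₂ 1+h′≡h) rewrite ≡ᵇ-≡ (sym 1+h′≡h) = B.∨-zeroʳ _

PathGraph-simple : ∀ k → IsSimpleGraph (PathGraph k)
PathGraph-simple k = (λ h h′ → B.∨-comm (toℕ h′ ≡ᵇ suc (toℕ h)) (toℕ h ≡ᵇ suc (toℕ h′))) ,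
  λ h → cong₂ _∨_ (≡ᵇ-≢ (ℕ.<⇒≢ (ℕ.n<1+n (toℕ h)))) (≡ᵇ-≢ (ℕ.<⇒≢ (ℕ.n<1+n (toℕ h))))

PathGraph-bipartite : ∀ k → Bipartite (PathGraph k)
PathGraph-bipartite k = colour , proper
  where
  colour : Fin k → Bool
  colour h = flipBy (parity (toℕ h)) false
  successor-flips : ∀ {h h′ : Fin k} → toℕ h′ ≡ suc (toℕ h) → colour h ≢ colour h′
  successor-flips {h} {h′} h′≡1+h e = B.not-¬ refl (trans e
    (trans (cong (λ m → flipBy (parity m) false) h′≡1+h) (flipBy-suc (toℕ h) false)))
  proper : ∀ h h′ → Adjacent (PathGraph k) h h′ → colour h ≢ colour h′
  proper h h′ adj with toℕ h′ ≡ᵇ suc (toℕ h) in e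
  ... | true = successor-flips {h} {h′} (≡ᵇ⇒≡ e)
  ... | false = successor-flips {h′} {h} (≡ᵇ⇒≡ adj) ∘ sym

injective⇒surjective : ∀ {m} (f : Fin m → Fin m) → Injective _≡_ _≡_ f → ∀ y → ∃[ x ] f x ≡ y
injective⇒surjective {suc m} f f-injective y with F.any? (λ x → f x ≟ y)
... | yes hit = hit
... | no miss = ⊥-elim (ℕ.1+n≰n (F.injective⇒≤ g-injective))
  where
  g : Fin (suc m) → Fin m
  g x = F.punchOut {i = y} {j = f x} (λ y≡fx → miss (x , sym y≡fx))
  g-injective : Injective _≡_ _≡_ g
  g-injective {x} {x′} e =
    f-injective (F.punchOut-injective {i = y}
      (λ y≡fx → miss (x , sym y≡fx)) (λ y≡fx′ → miss (x′ , sym y≡fx′)) e)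

injective⇒permutation : ∀ {m} (f : Fin m → Fin m) → Injective _≡_ _≡_ f → Permutation m m
injective⇒permutation f f-injective =
  permutation f (proj₁ ∘ surj) (proj₂ ∘ surj) (λ x → f-injective (proj₂ (surj (f x))))
  where
  surj : ∀ y → ∃[ x ] f x ≡ y
  surj = injective⇒surjective f f-injective

module ProductTour {n′ k′ : ℕ} (G : Graph (suc (suc n′))) (G-simple : IsSimpleGraph G)
  (G-bipartite : Bipartite G) (ham : HasHamiltonianPath G) where

  K : Graph (suc (suc k′))
  K = PathGraph (suc (suc k′))

  tour : Σ[ T ∈ GridPath (suc (suc n′)) (suc (suc k′)) ]
    (parity (suc (suc n′) * suc (suc k′)) ≡ 0ℙ → Closes T)
  tour = gridTour n′ k′

  Tour : GridPath (suc (suc n′)) (suc (suc k′))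
  Tour = proj₁ tour

  σ : Fin (suc (suc n′)) → Fin (suc (suc n′))
  σ = proj₁ ham

  vertex : Fin (suc (suc n′) * suc (suc k′)) → Fin (suc (suc n′) * suc (suc k′))
  vertex p = combine (σ (proj₁ (cell Tour p))) (proj₂ (cell Tour p))

  vertex-injective : Injective _≡_ _≡_ vertex
  vertex-injective {p} {q} e with F.combine-injective _ _ _ _ e
  ... | σi≡σi′ , h≡h′ =
    cell-injective Tour p q (cong₂ _,_ (proj₁ (proj₂ ham) σi≡σi′) h≡h′)

  π : Permutation (suc (suc n′) * suc (suc k′)) (suc (suc n′) * suc (suc k′))
  π = injective⇒permutation vertex vertex-injective

  H′ : Graph (suc (suc n′) * suc (suc k′))
  H′ = (G □ K) on (π ⟨$⟩ʳ_)

  grid⇒product : ∀ {i i′ : Fin (suc (suc n′))} {h h′ : Fin (suc (suc k′))} →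
    GridAdjacent (i , h) (i′ , h′) →
    Adjacent (G □ K) (combine (σ i) h) (combine (σ i′) h′)
  grid⇒product (inj₁ (refl , nb)) = □-adjacentʳ G K (σ _) (PathGraph-neighbours nb)
  grid⇒product (inj₂ (refl , inj₁ 1+i≡i′)) =
    □-adjacentˡ G K _ (proj₂ (proj₂ ham) _ _ (sym 1+i≡i′))
  grid⇒product (inj₂ (refl , inj₂ 1+i′≡i)) =
    □-adjacentˡ G K _ (trans (proj₁ G-simple _ _) (proj₂ (proj₂ ham) _ _ (sym 1+i′≡i)))

  M : ℕ
  M = suc k′ + suc n′ * suc (suc k′)

  tour-path : ∀ p q → toℕ q ≡ suc (toℕ p) → Adjacent H′ p q
  tour-path p q q≡1+p = grid⇒product (cell-step Tour p q q≡1+p)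

  tour-cycle : parity (suc M) ≡ 0ℙ → Adjacent H′ (F.fromℕ M) F.zero
  tour-cycle even =
    grid⇒product (proj₂ tour even F.zero (F.fromℕ M) refl (cong suc (F.toℕ-fromℕ M)))

  open PathOrdered H′ (on-simple (π ⟨$⟩ʳ_) (□-simple G K G-simple (PathGraph-simple _)))
    (on-bipartite (π ⟨$⟩ʳ_) (□-bipartite G K G-bipartite (PathGraph-bipartite _)))
    (s≤s (ℕ.≤-trans (s≤s (s≤s z≤n)) (ℕ.m≤n+m _ k′)))
    tour-path tour-cycle
    public using (foolsNumber≡α-1)

theorem3p6 : ∀ {n} (G : Graph n) → IsSimpleGraph G → 2 ≤ n → Connected G →
    Bipartite G → HasHamiltonianPath G → ∀ (k : ℕ) → 2 ≤ k → ∀ (a : ℕ) →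
    IsIndependenceNumber (G □ PathGraph k) a →
    IsFoolsSolitaireNumber (G □ PathGraph k) (a ∸ 1)
theorem3p6 {suc (suc n′)} G G-simple (s≤s (s≤s z≤n)) _ G-bipartite ham (suc (suc k′)) (s≤s (s≤s z≤n))
  a α-is-a = foolsNumber-relabel π (λ _ _ → refl)
               (foolsNumber≡α-1 a (independenceNumber-relabel π (λ _ _ → refl) α-is-a))
  where open ProductTour {k′ = k′} G G-simple G-bipartite ham
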